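{- Let $K$ be a field, let $A\in K[X]$ be monic of degree $3$, and let $R(X)=-v(X-w)$ with $v,w\in K$, $v\neq 0$. Suppose that for all $h\in\mathbb Z$ we are given $d_h,e_h\in K$, with $P_h(X)=d_h(X+e_h)$, polynomials $Q_h\in K[X]$ of degree exactly $2$, and $a_h\in K[X]$, such that $$P_h+P_{h+1}+A=a_hQ_h\qquad\text{and}\qquad -Q_hQ_{h+1}=-R+P_{h+1}(A+P_{h+1}).$$ Then for all $h$, $$d_{h-2}\,d_{h-1}^2\,d_h^3\,d_{h+1}^2\,d_{h+2}=v^2\,d_{h-1}d_h^2d_{h+1}-v^3A(w).$$
   Context: These relations are the data of the continued fraction expansion $\frac{Z+P_h}{Q_h}=a_h-\frac{\bar Z+P_{h+1}}{Q_{h+1}}$ of $(Z+P_0)/Q_0$, where $Z^2-AZ-R=0$ (genus $2$ case, $D=A^2+4R$ monic of degree $6$), with all partial quotients of degree $1$. -}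

module Defs where

open import Level using (_⊔_; suc)
open import Algebra.Bundles using (CommutativeRing)
open import Data.Nat using (ℕ; zero; suc; _>_)
open import Data.List using (List; []; _∷_)
open import Relation.Nullary using (¬_)
open import Data.Product using (Σ; _×_)

record Field (c ℓ : Level.Level) : Set (Level.suc (c ⊔ ℓ)) where
  field
    commutativeRing : CommutativeRing c ℓ
  open CommutativeRing commutativeRing public
  field
    1≉0 : ¬ (1# ≈ 0#)
    inverse : ∀ x → ¬ (x ≈ 0#) → Σ Carrier (λ y → x * y ≈ 1#)

-- Univariate polynomials over a field, as coefficient lists
-- (lowest degree first); equality is coefficientwise.
module Poly {c ℓ} (F : Field c ℓ) where
  open Field F

  K[X] : Set c
  K[X] = List Carrier

  coeff : K[X] → ℕ → Carrier
  coeff []       _       = 0#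
  coeff (a ∷ p)  zero    = a
  coeff (a ∷ p)  (suc n) = coeff p n

  infix  4 _≈ₚ_
  infixl 6 _+ₚ_
  infixl 7 _*ₚ_ _·ₚ_

  _≈ₚ_ : K[X] → K[X] → Set ℓ
  p ≈ₚ q = ∀ n → coeff p n ≈ coeff q n

  _+ₚ_ : K[X] → K[X] → K[X]
  []      +ₚ q       = q
  (a ∷ p) +ₚ []      = a ∷ p
  (a ∷ p) +ₚ (b ∷ q) = (a + b) ∷ (p +ₚ q)

  _·ₚ_ : Carrier → K[X] → K[X]
  k ·ₚ []      = []
  k ·ₚ (a ∷ p) = (k * a) ∷ (k ·ₚ p)

  -ₚ_ : K[X] → K[X]
  -ₚ p = (- 1#) ·ₚ p

  _*ₚ_ : K[X] → K[X] → K[X]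
  []      *ₚ q = []
  (a ∷ p) *ₚ q = (a ·ₚ q) +ₚ (0# ∷ (p *ₚ q))

  eval : K[X] → Carrier → Carrier
  eval []      x = 0#
  eval (a ∷ p) x = a + x * eval p x

  lin : Carrier → Carrier → K[X]
  lin a b = a ∷ b ∷ []

  HasDegree : K[X] → ℕ → Set ℓ
  HasDegree p n = (¬ (coeff p n ≈ 0#)) × (∀ m → m > n → coeff p m ≈ 0#)

  MonicOfDegree : K[X] → ℕ → Set ℓ
  MonicOfDegree p n = (coeff p n ≈ 1#) × (∀ m → m > n → coeff p m ≈ 0#)

{-# OPTIONS --safe #-}
-- Eliminating A between the two relations at consecutive indices gives
--   (Q_h + P_{h+1} a_{h+1}) Q_{h+1} = R + P_{h+1} P_{h+2}.
-- The right-hand side has degree 2 and Q_{h+1} has degree exactly 2, so m_h := Q_h + P_{h+1} a_{h+1}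
-- is a constant. Evaluating at the root -e_{h+2} of P_{h+2} gives m_h m_{h+1} = v (w + e_{h+2}), and
-- comparing leading coefficients (the top coefficient of the second relation says
-- -lc(Q_h) lc(Q_{h+1}) = d_{h+1}) turns this into v (w + e_k) = -d_{k-1} d_k d_{k+1}.
-- Evaluating the identity above and the second relation at the root w of R gives
--   m_{h-1} Q_h(w) = P_h(w) P_{h+1}(w)   and   -Q_{h-1}(w) Q_h(w) = P_h(w) (A(w) + P_h(w)),
-- and combining these at h-1 and h, cancelling d_h (w + e_h)^2 and substituting
-- v (w + e_k) = -d_{k-1} d_k d_{k+1} for k = h-1, h, h+1 yields the relation.
module Submission where

open import Defs
open import Level using (Level)
open import Data.Integer using (ℤ; +_) renaming (_+_ to _+ℤ_; _-_ to _-ℤ_)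
open import Data.Product using (_×_)
open import Relation.Nullary using (¬_)

open import Algebra.Bundles using (CommutativeRing)
open import Data.Integer as ℤ using (-[1+_]; _⊖_; sign; ∣_∣; _◃_)
import Data.Integer.Properties as ℤ
open import Data.List using ([]; _∷_; length)
open import Data.Maybe using (Maybe; just; nothing)
open import Data.Nat as ℕ using (ℕ; zero; suc)
import Data.Nat.Properties as ℕ
open import Data.Product using (_,_)
open import Data.Sign as Sign using (Sign)
open import Function using (_∘_)
open import Relation.Binary.PropositionalEquality as ≡ using (_≡_)
open import Relation.Nullary using (yes; no)

-- Algebra.Solver.Ring for an arbitrary commutative ring, with integer coefficients: the solvers whose
-- coefficients live in the ring itself cannot decide equations such as 1 + (-1) = 0 there.
module IntegerCoefficients {c ℓ} (R : CommutativeRing c ℓ) where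
  open CommutativeRing R
  open import Algebra.Properties.Ring ring using (-0#≈0#; -‿involutive; -‿distribˡ-*; -‿distribʳ-*; -‿+-comm)
  open import Algebra.Properties.CommutativeSemigroup +-commutativeSemigroup using (interchange)
  open import Algebra.Properties.Semiring.Mult semiring using (×-homo-+; ×1-homo-*) renaming (_×_ to _×ᵤ_)
  open import Algebra.Solver.Ring.AlmostCommutativeRing using (fromCommutativeRing; _-Raw-AlmostCommutative⟶_)
  open import Relation.Binary.Reasoning.Setoid setoid

  ⟦_⟧ : ℤ → Carrier
  ⟦ + n ⟧      = n ×ᵤ 1#
  ⟦ -[1+ n ] ⟧ = - (suc n ×ᵤ 1#)

  private
    signed : Sign → Carrier → Carrier
    signed Sign.+ x = x
    signed Sign.- x = - x

    signed-cong : ∀ s {x y} → x ≈ y → signed s x ≈ signed s y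
    signed-cong Sign.+ x≈y = x≈y
    signed-cong Sign.- x≈y = -‿cong x≈y

    signed-* : ∀ s t x y → signed (s Sign.* t) (x * y) ≈ signed s x * signed t y
    signed-* Sign.+ Sign.+ x y = refl
    signed-* Sign.+ Sign.- x y = -‿distribʳ-* x y
    signed-* Sign.- Sign.+ x y = -‿distribˡ-* x y
    signed-* Sign.- Sign.- x y = begin
      x * y         ≈⟨ -‿involutive (x * y) ⟨
      - - (x * y)   ≈⟨ -‿cong (-‿distribˡ-* x y) ⟩
      - (- x * y)   ≈⟨ -‿distribʳ-* (- x) y ⟩
      - x * - y     ∎

    ⟦⟧-signed : ∀ i → ⟦ i ⟧ ≈ signed (sign i) (∣ i ∣ ×ᵤ 1#)
    ⟦⟧-signed (+ n)    = refl
    ⟦⟧-signed -[1+ n ] = refl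

    ⟦◃⟧ : ∀ s n → ⟦ s ◃ n ⟧ ≈ signed s (n ×ᵤ 1#)
    ⟦◃⟧ Sign.+ zero    = refl
    ⟦◃⟧ Sign.- zero    = sym -0#≈0#
    ⟦◃⟧ Sign.+ (suc n) = refl
    ⟦◃⟧ Sign.- (suc n) = refl

    ⟦⊖⟧ : ∀ m n → ⟦ m ⊖ n ⟧ ≈ m ×ᵤ 1# - n ×ᵤ 1#
    ⟦⊖⟧ zero    zero    = sym (trans (+-congˡ -0#≈0#) (+-identityʳ 0#))
    ⟦⊖⟧ (suc m) zero    = sym (trans (+-congˡ -0#≈0#) (+-identityʳ _))
    ⟦⊖⟧ zero    (suc n) = sym (+-identityˡ _)
    ⟦⊖⟧ (suc m) (suc n) = begin
      ⟦ suc m ⊖ suc n ⟧                    ≡⟨ ≡.cong ⟦_⟧ (ℤ.[1+m]⊖[1+n]≡m⊖n m n) ⟩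
      ⟦ m ⊖ n ⟧                            ≈⟨ ⟦⊖⟧ m n ⟩
      m ×ᵤ 1# - n ×ᵤ 1#                    ≈⟨ +-identityˡ _ ⟨
      0# + (m ×ᵤ 1# - n ×ᵤ 1#)             ≈⟨ +-congʳ (-‿inverseʳ 1#) ⟨
      (1# - 1#) + (m ×ᵤ 1# - n ×ᵤ 1#)      ≈⟨ interchange 1# (- 1#) (m ×ᵤ 1#) (- (n ×ᵤ 1#)) ⟩
      (1# + m ×ᵤ 1#) + (- 1# - n ×ᵤ 1#)    ≈⟨ +-congˡ (-‿+-comm 1# (n ×ᵤ 1#)) ⟩
      suc m ×ᵤ 1# - suc n ×ᵤ 1#            ∎

  +-homo : ∀ i j → ⟦ i ℤ.+ j ⟧ ≈ ⟦ i ⟧ + ⟦ j ⟧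
  +-homo (+ m)    (+ n)    = ×-homo-+ 1# m n
  +-homo (+ m)    -[1+ n ] = ⟦⊖⟧ m (suc n)
  +-homo -[1+ m ] (+ n)    = trans (⟦⊖⟧ n (suc m)) (+-comm _ _)
  +-homo -[1+ m ] -[1+ n ] = begin
    - (suc (suc (m ℕ.+ n)) ×ᵤ 1#)       ≡⟨ ≡.cong (λ k → - (k ×ᵤ 1#)) (ℕ.+-suc (suc m) n) ⟨
    - ((suc m ℕ.+ suc n) ×ᵤ 1#)         ≈⟨ -‿cong (×-homo-+ 1# (suc m) (suc n)) ⟩
    - (suc m ×ᵤ 1# + suc n ×ᵤ 1#)       ≈⟨ -‿+-comm _ _ ⟨
    - (suc m ×ᵤ 1#) + - (suc n ×ᵤ 1#)   ∎

  *-homo : ∀ i j → ⟦ i ℤ.* j ⟧ ≈ ⟦ i ⟧ * ⟦ j ⟧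
  *-homo i j = begin
    ⟦ (sign i Sign.* sign j) ◃ (∣ i ∣ ℕ.* ∣ j ∣) ⟧
      ≈⟨ ⟦◃⟧ (sign i Sign.* sign j) (∣ i ∣ ℕ.* ∣ j ∣) ⟩
    signed (sign i Sign.* sign j) ((∣ i ∣ ℕ.* ∣ j ∣) ×ᵤ 1#)
      ≈⟨ signed-cong (sign i Sign.* sign j) (×1-homo-* ∣ i ∣ ∣ j ∣) ⟩
    signed (sign i Sign.* sign j) ((∣ i ∣ ×ᵤ 1#) * (∣ j ∣ ×ᵤ 1#))
      ≈⟨ signed-* (sign i) (sign j) _ _ ⟩
    signed (sign i) (∣ i ∣ ×ᵤ 1#) * signed (sign j) (∣ j ∣ ×ᵤ 1#)
      ≈⟨ *-cong (⟦⟧-signed i) (⟦⟧-signed j) ⟨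
    ⟦ i ⟧ * ⟦ j ⟧ ∎

  -‿homo : ∀ i → ⟦ ℤ.- i ⟧ ≈ - ⟦ i ⟧
  -‿homo (+ zero)  = sym -0#≈0#
  -‿homo (+ suc n) = refl
  -‿homo -[1+ n ]  = sym (-‿involutive _)

  homomorphism : ℤ.+-*-rawRing -Raw-AlmostCommutative⟶ fromCommutativeRing R
  homomorphism = record
    { ⟦_⟧    = ⟦_⟧
    ; +-homo = +-homo
    ; *-homo = *-homo
    ; -‿homo = -‿homo
    ; 0-homo = refl
    ; 1-homo = +-identityʳ 1#
    }

  private
    equal? : ∀ i j → Maybe (⟦ i ⟧ ≈ ⟦ j ⟧)
    equal? i j with i ℤ.≟ j
    ... | yes ≡.refl = just refl
    ... | no _       = nothing

  open import Algebra.Solver.Ring ℤ.+-*-rawRing (fromCommutativeRing R) homomorphism equal?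
    public using (solve; _:=_; _:+_; _:*_; _:-_; :-_)

module FieldProperties {c ℓ} (F : Field c ℓ) where
  open Field F
  open import Algebra.Properties.Ring ring using (-0#≈0#; -‿involutive)
  open import Relation.Binary.Reasoning.Setoid setoid

  *-cancelˡ : ∀ {x y z} → ¬ x ≈ 0# → x * y ≈ x * z → y ≈ z
  *-cancelˡ {x} {y} {z} x≉0 xy≈xz with inverse x x≉0
  ... | x⁻¹ , xx⁻¹≈1 = begin
    y              ≈⟨ x⁻¹-cancels y ⟨
    x⁻¹ * (x * y)  ≈⟨ *-congˡ xy≈xz ⟩
    x⁻¹ * (x * z)  ≈⟨ x⁻¹-cancels z ⟩
    z              ∎
    where
    x⁻¹-cancels : ∀ t → x⁻¹ * (x * t) ≈ t
    x⁻¹-cancels t = begin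
      x⁻¹ * (x * t)  ≈⟨ *-assoc x⁻¹ x t ⟨
      x⁻¹ * x * t    ≈⟨ *-congʳ (trans (*-comm x⁻¹ x) xx⁻¹≈1) ⟩
      1# * t         ≈⟨ *-identityˡ t ⟩
      t              ∎

  *-cancelʳ : ∀ {x y z} → ¬ z ≈ 0# → x * z ≈ y * z → x ≈ y
  *-cancelʳ {x} {y} {z} z≉0 xz≈yz = *-cancelˡ z≉0 (trans (*-comm z x) (trans xz≈yz (*-comm y z)))

  x≉0∧y≉0⇒x*y≉0 : ∀ {x y} → ¬ x ≈ 0# → ¬ y ≈ 0# → ¬ x * y ≈ 0#
  x≉0∧y≉0⇒x*y≉0 {x} x≉0 y≉0 xy≈0 = y≉0 (*-cancelˡ x≉0 (trans xy≈0 (sym (zeroʳ x))))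

  x≈-y⇒y≈-x : ∀ {x y} → x ≈ - y → y ≈ - x
  x≈-y⇒y≈-x {x} {y} x≈-y = trans (sym (-‿involutive y)) (-‿cong (sym x≈-y))

  x≉0⇒-x≉0 : ∀ {x} → ¬ x ≈ 0# → ¬ - x ≈ 0#
  x≉0⇒-x≉0 {x} x≉0 -x≈0 = x≉0 (trans (sym (-‿involutive x)) (trans (-‿cong -x≈0) -0#≈0#))

module PolynomialEquality {c ℓ} (F : Field c ℓ) where
  open Field F
  open Poly F
  open import Algebra.Properties.CommutativeSemigroup +-commutativeSemigroup using (interchange; xy∙z≈zx∙y)
  open import Algebra.Properties.Ring ring using (-1*x≈-x)
  open IntegerCoefficients commutativeRing using (solve; _:=_; _:+_; _:-_; :-_)
  open import Relation.Binary.Bundles using (Setoid)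
  open import Relation.Binary.Reasoning.Setoid setoid

  infix 4 _≋_

  -- _≈ₚ_ wrapped in a record, so that Agda can recover the two polynomials from an equation's type.
  record _≋_ (p q : K[X]) : Set ℓ where
    constructor coeffwise
    field coeff-≈ : ∀ n → coeff p n ≈ coeff q n

  open _≋_ public

  ≋-refl : ∀ {p} → p ≋ p
  ≋-refl = coeffwise λ _ → refl

  ≋-sym : ∀ {p q} → p ≋ q → q ≋ p
  ≋-sym (coeffwise p≈q) = coeffwise λ n → sym (p≈q n)

  ≋-trans : ∀ {p q r} → p ≋ q → q ≋ r → p ≋ r
  ≋-trans (coeffwise p≈q) (coeffwise q≈r) = coeffwise λ n → trans (p≈q n) (q≈r n)

  K[X]-setoid : Setoid c ℓ
  K[X]-setoid = record
    { Carrier       = K[X]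
    ; _≈_           = _≋_
    ; isEquivalence = record { refl = ≋-refl ; sym = ≋-sym ; trans = ≋-trans }
    }

  ∷-cong : ∀ {a b p q} → a ≈ b → p ≋ q → a ∷ p ≋ b ∷ q
  ∷-cong a≈b (coeffwise p≈q) = coeffwise λ where
    zero    → a≈b
    (suc n) → p≈q n

  coeff-+ₚ : ∀ p q n → coeff (p +ₚ q) n ≈ coeff p n + coeff q n
  coeff-+ₚ []      q       n       = sym (+-identityˡ _)
  coeff-+ₚ (a ∷ p) []      n       = sym (+-identityʳ _)
  coeff-+ₚ (a ∷ p) (b ∷ q) zero    = refl
  coeff-+ₚ (a ∷ p) (b ∷ q) (suc n) = coeff-+ₚ p q n

  coeff-·ₚ : ∀ k p n → coeff (k ·ₚ p) n ≈ k * coeff p n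
  coeff-·ₚ k []      n       = sym (zeroʳ k)
  coeff-·ₚ k (a ∷ p) zero    = refl
  coeff-·ₚ k (a ∷ p) (suc n) = coeff-·ₚ k p n

  +ₚ-cong : ∀ {p p′ q q′} → p ≋ p′ → q ≋ q′ → p +ₚ q ≋ p′ +ₚ q′
  +ₚ-cong {p} {p′} {q} {q′} (coeffwise p≈p′) (coeffwise q≈q′) = coeffwise λ n → begin
    coeff (p +ₚ q) n        ≈⟨ coeff-+ₚ p q n ⟩
    coeff p n + coeff q n   ≈⟨ +-cong (p≈p′ n) (q≈q′ n) ⟩
    coeff p′ n + coeff q′ n ≈⟨ coeff-+ₚ p′ q′ n ⟨
    coeff (p′ +ₚ q′) n      ∎

  +ₚ-congˡ : ∀ {p q q′} → q ≋ q′ → p +ₚ q ≋ p +ₚ q′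
  +ₚ-congˡ = +ₚ-cong ≋-refl

  +ₚ-congʳ : ∀ {p p′ q} → p ≋ p′ → p +ₚ q ≋ p′ +ₚ q
  +ₚ-congʳ p≋p′ = +ₚ-cong p≋p′ ≋-refl

  +ₚ-identityʳ : ∀ p → p +ₚ [] ≋ p
  +ₚ-identityʳ []      = ≋-refl
  +ₚ-identityʳ (a ∷ p) = ≋-refl

  +ₚ-assoc : ∀ p q r → (p +ₚ q) +ₚ r ≋ p +ₚ (q +ₚ r)
  +ₚ-assoc p q r = coeffwise λ n → begin
    coeff ((p +ₚ q) +ₚ r) n               ≈⟨ trans (coeff-+ₚ (p +ₚ q) r n) (+-congʳ (coeff-+ₚ p q n)) ⟩
    (coeff p n + coeff q n) + coeff r n   ≈⟨ +-assoc _ _ _ ⟩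
    coeff p n + (coeff q n + coeff r n)   ≈⟨ trans (coeff-+ₚ p (q +ₚ r) n) (+-congˡ (coeff-+ₚ q r n)) ⟨
    coeff (p +ₚ (q +ₚ r)) n               ∎

  +ₚ-interchange : ∀ p q r s → (p +ₚ q) +ₚ (r +ₚ s) ≋ (p +ₚ r) +ₚ (q +ₚ s)
  +ₚ-interchange p q r s = coeffwise λ n → begin
    coeff ((p +ₚ q) +ₚ (r +ₚ s)) n
      ≈⟨ trans (coeff-+ₚ (p +ₚ q) (r +ₚ s) n) (+-cong (coeff-+ₚ p q n) (coeff-+ₚ r s n)) ⟩
    (coeff p n + coeff q n) + (coeff r n + coeff s n)
      ≈⟨ interchange _ _ _ _ ⟩
    (coeff p n + coeff r n) + (coeff q n + coeff s n)
      ≈⟨ trans (coeff-+ₚ (p +ₚ r) (q +ₚ s) n) (+-cong (coeff-+ₚ p r n) (coeff-+ₚ q s n)) ⟨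
    coeff ((p +ₚ r) +ₚ (q +ₚ s)) n
      ∎

  +ₚ-xy∙z≈zx∙y : ∀ p q r → (p +ₚ q) +ₚ r ≋ (r +ₚ p) +ₚ q
  +ₚ-xy∙z≈zx∙y p q r = coeffwise λ n → begin
    coeff ((p +ₚ q) +ₚ r) n               ≈⟨ trans (coeff-+ₚ (p +ₚ q) r n) (+-congʳ (coeff-+ₚ p q n)) ⟩
    (coeff p n + coeff q n) + coeff r n   ≈⟨ xy∙z≈zx∙y _ _ _ ⟩
    (coeff r n + coeff p n) + coeff q n   ≈⟨ trans (coeff-+ₚ (r +ₚ p) q n) (+-congʳ (coeff-+ₚ r p n)) ⟨
    coeff ((r +ₚ p) +ₚ q) n               ∎

  coeff--ₚ : ∀ p n → coeff (-ₚ p) n ≈ - coeff p n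
  coeff--ₚ p n = trans (coeff-·ₚ (- 1#) p n) (-1*x≈-x _)

  -ₚp≋-ₚr+ₚs⇒p+ₚs≋r : ∀ p r s → -ₚ p ≋ -ₚ r +ₚ s → p +ₚ s ≋ r
  -ₚp≋-ₚr+ₚs⇒p+ₚs≋r p r s (coeffwise -p≈-r+s) = coeffwise λ n → begin
    coeff (p +ₚ s) n
      ≈⟨ coeff-+ₚ p s n ⟩
    coeff p n + coeff s n
      ≈⟨ solve 3 (λ p r s → p :+ s := r :+ (:- r :+ s) :- :- p) refl (coeff p n) (coeff r n) (coeff s n) ⟩
    coeff r n + (- coeff r n + coeff s n) - - coeff p n
      ≈⟨ +-congʳ (+-congˡ (-r+s≈-p n)) ⟩
    coeff r n + - coeff p n - - coeff p n
      ≈⟨ solve 2 (λ p r → r :+ :- p :- :- p := r) refl (coeff p n) (coeff r n) ⟩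
    coeff r n
      ∎
    where
    -r+s≈-p : ∀ n → - coeff r n + coeff s n ≈ - coeff p n
    -r+s≈-p n = begin
      - coeff r n + coeff s n     ≈⟨ +-congʳ (coeff--ₚ r n) ⟨
      coeff (-ₚ r) n + coeff s n  ≈⟨ coeff-+ₚ (-ₚ r) s n ⟨
      coeff (-ₚ r +ₚ s) n         ≈⟨ -p≈-r+s n ⟨
      coeff (-ₚ p) n              ≈⟨ coeff--ₚ p n ⟩
      - coeff p n                 ∎

  ·ₚ-congʳ : ∀ k {p q} → p ≋ q → k ·ₚ p ≋ k ·ₚ q
  ·ₚ-congʳ k {p} {q} (coeffwise p≈q) = coeffwise λ n → begin
    coeff (k ·ₚ p) n  ≈⟨ coeff-·ₚ k p n ⟩
    k * coeff p n     ≈⟨ *-congˡ (p≈q n) ⟩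
    k * coeff q n     ≈⟨ coeff-·ₚ k q n ⟨
    coeff (k ·ₚ q) n  ∎

  ·ₚ-zero : ∀ {k} p → k ≈ 0# → k ·ₚ p ≋ []
  ·ₚ-zero {k} p k≈0 = coeffwise λ n → begin
    coeff (k ·ₚ p) n  ≈⟨ coeff-·ₚ k p n ⟩
    k * coeff p n     ≈⟨ *-congʳ k≈0 ⟩
    0# * coeff p n    ≈⟨ zeroˡ _ ⟩
    0#                ∎

  ·ₚ-distribˡ : ∀ k p q → k ·ₚ (p +ₚ q) ≋ k ·ₚ p +ₚ k ·ₚ q
  ·ₚ-distribˡ k p q = coeffwise λ n → begin
    coeff (k ·ₚ (p +ₚ q)) n
      ≈⟨ trans (coeff-·ₚ k (p +ₚ q) n) (*-congˡ (coeff-+ₚ p q n)) ⟩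
    k * (coeff p n + coeff q n)
      ≈⟨ distribˡ k _ _ ⟩
    k * coeff p n + k * coeff q n
      ≈⟨ trans (coeff-+ₚ (k ·ₚ p) (k ·ₚ q) n) (+-cong (coeff-·ₚ k p n) (coeff-·ₚ k q n)) ⟨
    coeff (k ·ₚ p +ₚ k ·ₚ q) n
      ∎

  ·ₚ-distribʳ : ∀ k l p → (k + l) ·ₚ p ≋ k ·ₚ p +ₚ l ·ₚ p
  ·ₚ-distribʳ k l p = coeffwise λ n → begin
    coeff ((k + l) ·ₚ p) n
      ≈⟨ coeff-·ₚ (k + l) p n ⟩
    (k + l) * coeff p n
      ≈⟨ distribʳ _ k l ⟩
    k * coeff p n + l * coeff p n
      ≈⟨ trans (coeff-+ₚ (k ·ₚ p) (l ·ₚ p) n) (+-cong (coeff-·ₚ k p n) (coeff-·ₚ l p n)) ⟨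
    coeff (k ·ₚ p +ₚ l ·ₚ p) n
      ∎

  ·ₚ-assoc : ∀ k l p → (k * l) ·ₚ p ≋ k ·ₚ (l ·ₚ p)
  ·ₚ-assoc k l p = coeffwise λ n → begin
    coeff ((k * l) ·ₚ p) n                   ≈⟨ coeff-·ₚ (k * l) p n ⟩
    (k * l) * coeff p n                      ≈⟨ *-assoc k l _ ⟩
    k * (l * coeff p n)                      ≈⟨ trans (coeff-·ₚ k (l ·ₚ p) n) (*-congˡ (coeff-·ₚ l p n)) ⟨
    coeff (k ·ₚ (l ·ₚ p)) n                  ∎

module PolynomialMultiplication {c ℓ} (F : Field c ℓ) where
  open Field F hiding (zero)
  open Poly F
  open PolynomialEquality F
  open import Relation.Binary.Reasoning.Setoid K[X]-setoid

  *ₚ-zeroˡ : ∀ p q → p ≋ [] → p *ₚ q ≋ []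
  *ₚ-zeroˡ []      q p≋[]                = ≋-refl
  *ₚ-zeroˡ (a ∷ p) q (coeffwise a∷p≈0) = begin
    a ·ₚ q +ₚ (0# ∷ p *ₚ q)
      ≈⟨ +ₚ-cong (·ₚ-zero q (a∷p≈0 zero)) (∷-cong refl (*ₚ-zeroˡ p q (coeffwise (a∷p≈0 ∘ suc)))) ⟩
    0# ∷ []
      ≈⟨ coeffwise (λ { zero → refl ; (suc n) → refl }) ⟩
    []
      ∎

  *ₚ-congʳ : ∀ p {q q′} → q ≋ q′ → p *ₚ q ≋ p *ₚ q′
  *ₚ-congʳ []      q≋q′ = ≋-refl
  *ₚ-congʳ (a ∷ p) q≋q′ = +ₚ-cong (·ₚ-congʳ a q≋q′) (∷-cong refl (*ₚ-congʳ p q≋q′))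

  *ₚ-distribˡ : ∀ p q r → p *ₚ (q +ₚ r) ≋ p *ₚ q +ₚ p *ₚ r
  *ₚ-distribˡ []      q r = ≋-refl
  *ₚ-distribˡ (a ∷ p) q r = begin
    a ·ₚ (q +ₚ r) +ₚ (0# ∷ p *ₚ (q +ₚ r))
      ≈⟨ +ₚ-cong (·ₚ-distribˡ a q r) (∷-cong (sym (+-identityʳ 0#)) (*ₚ-distribˡ p q r)) ⟩
    (a ·ₚ q +ₚ a ·ₚ r) +ₚ ((0# ∷ p *ₚ q) +ₚ (0# ∷ p *ₚ r))
      ≈⟨ +ₚ-interchange (a ·ₚ q) (a ·ₚ r) (0# ∷ p *ₚ q) (0# ∷ p *ₚ r) ⟩
    (a ·ₚ q +ₚ (0# ∷ p *ₚ q)) +ₚ (a ·ₚ r +ₚ (0# ∷ p *ₚ r))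
      ∎

  *ₚ-distribʳ : ∀ p q r → (p +ₚ q) *ₚ r ≋ p *ₚ r +ₚ q *ₚ r
  *ₚ-distribʳ []      q       r = ≋-refl
  *ₚ-distribʳ (a ∷ p) []      r = ≋-sym (+ₚ-identityʳ _)
  *ₚ-distribʳ (a ∷ p) (b ∷ q) r = begin
    (a + b) ·ₚ r +ₚ (0# ∷ (p +ₚ q) *ₚ r)
      ≈⟨ +ₚ-cong (·ₚ-distribʳ a b r) (∷-cong (sym (+-identityʳ 0#)) (*ₚ-distribʳ p q r)) ⟩
    (a ·ₚ r +ₚ b ·ₚ r) +ₚ ((0# ∷ p *ₚ r) +ₚ (0# ∷ q *ₚ r))
      ≈⟨ +ₚ-interchange (a ·ₚ r) (b ·ₚ r) (0# ∷ p *ₚ r) (0# ∷ q *ₚ r) ⟩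
    (a ·ₚ r +ₚ (0# ∷ p *ₚ r)) +ₚ (b ·ₚ r +ₚ (0# ∷ q *ₚ r))
      ∎

  ·ₚ-*ₚ-assoc : ∀ k p q → (k ·ₚ p) *ₚ q ≋ k ·ₚ (p *ₚ q)
  ·ₚ-*ₚ-assoc k []      q = ≋-refl
  ·ₚ-*ₚ-assoc k (a ∷ p) q = begin
    (k * a) ·ₚ q +ₚ (0# ∷ (k ·ₚ p) *ₚ q)
      ≈⟨ +ₚ-cong (·ₚ-assoc k a q) (∷-cong (sym (zeroʳ k)) (·ₚ-*ₚ-assoc k p q)) ⟩
    k ·ₚ (a ·ₚ q) +ₚ k ·ₚ (0# ∷ p *ₚ q)
      ≈⟨ ·ₚ-distribˡ k (a ·ₚ q) (0# ∷ p *ₚ q) ⟨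
    k ·ₚ (a ·ₚ q +ₚ (0# ∷ p *ₚ q))
      ∎

  *ₚ-assoc : ∀ p q r → (p *ₚ q) *ₚ r ≋ p *ₚ (q *ₚ r)
  *ₚ-assoc []      q r = ≋-refl
  *ₚ-assoc (a ∷ p) q r = begin
    (a ·ₚ q +ₚ (0# ∷ p *ₚ q)) *ₚ r
      ≈⟨ *ₚ-distribʳ (a ·ₚ q) (0# ∷ p *ₚ q) r ⟩
    (a ·ₚ q) *ₚ r +ₚ (0# ·ₚ r +ₚ (0# ∷ (p *ₚ q) *ₚ r))
      ≈⟨ +ₚ-cong (·ₚ-*ₚ-assoc a q r) (+ₚ-congʳ (·ₚ-zero r refl)) ⟩
    a ·ₚ (q *ₚ r) +ₚ (0# ∷ (p *ₚ q) *ₚ r)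
      ≈⟨ +ₚ-congˡ (∷-cong refl (*ₚ-assoc p q r)) ⟩
    a ·ₚ (q *ₚ r) +ₚ (0# ∷ p *ₚ (q *ₚ r))
      ∎

  eliminate-A : ∀ Q Q₁ P₁ P₂ A a₁ R →
                P₁ +ₚ P₂ +ₚ A ≋ a₁ *ₚ Q₁ → -ₚ (Q *ₚ Q₁) ≋ -ₚ R +ₚ P₁ *ₚ (A +ₚ P₁) →
                (Q +ₚ P₁ *ₚ a₁) *ₚ Q₁ ≋ R +ₚ P₁ *ₚ P₂
  eliminate-A Q Q₁ P₁ P₂ A a₁ R sum product = begin
    (Q +ₚ P₁ *ₚ a₁) *ₚ Q₁
      ≈⟨ *ₚ-distribʳ Q (P₁ *ₚ a₁) Q₁ ⟩
    Q *ₚ Q₁ +ₚ (P₁ *ₚ a₁) *ₚ Q₁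
      ≈⟨ +ₚ-congˡ (*ₚ-assoc P₁ a₁ Q₁) ⟩
    Q *ₚ Q₁ +ₚ P₁ *ₚ (a₁ *ₚ Q₁)
      ≈⟨ +ₚ-congˡ (*ₚ-congʳ P₁ (≋-sym sum)) ⟩
    Q *ₚ Q₁ +ₚ P₁ *ₚ (P₁ +ₚ P₂ +ₚ A)
      ≈⟨ +ₚ-congˡ (*ₚ-congʳ P₁ (+ₚ-xy∙z≈zx∙y P₁ P₂ A)) ⟩
    Q *ₚ Q₁ +ₚ P₁ *ₚ (A +ₚ P₁ +ₚ P₂)
      ≈⟨ +ₚ-congˡ (*ₚ-distribˡ P₁ (A +ₚ P₁) P₂) ⟩
    Q *ₚ Q₁ +ₚ (P₁ *ₚ (A +ₚ P₁) +ₚ P₁ *ₚ P₂)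
      ≈⟨ +ₚ-assoc (Q *ₚ Q₁) (P₁ *ₚ (A +ₚ P₁)) (P₁ *ₚ P₂) ⟨
    Q *ₚ Q₁ +ₚ P₁ *ₚ (A +ₚ P₁) +ₚ P₁ *ₚ P₂
      ≈⟨ +ₚ-congʳ (-ₚp≋-ₚr+ₚs⇒p+ₚs≋r (Q *ₚ Q₁) R (P₁ *ₚ (A +ₚ P₁)) product) ⟩
    R +ₚ P₁ *ₚ P₂
      ∎

module PolynomialEvaluation {c ℓ} (F : Field c ℓ) where
  open Field F hiding (zero)
  open Poly F
  open PolynomialEquality F
  open IntegerCoefficients commutativeRing using (solve; _:=_; _:+_; _:*_)
  open import Algebra.Properties.Ring ring using (-1*x≈-x)
  open import Relation.Binary.Reasoning.Setoid setoid

  eval-zero : ∀ p x → p ≋ [] → eval p x ≈ 0#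
  eval-zero []      x _                   = refl
  eval-zero (a ∷ p) x (coeffwise a∷p≈0) = begin
    a + x * eval p x  ≈⟨ +-cong (a∷p≈0 zero) (*-congˡ (eval-zero p x (coeffwise (a∷p≈0 ∘ suc)))) ⟩
    0# + x * 0#       ≈⟨ trans (+-identityˡ _) (zeroʳ x) ⟩
    0#                ∎

  eval-cong : ∀ {p q} x → p ≋ q → eval p x ≈ eval q x
  eval-cong {[]}    {q}     x p≋q              = sym (eval-zero q x (≋-sym p≋q))
  eval-cong {a ∷ p} {[]}    x p≋q              = eval-zero (a ∷ p) x p≋q
  eval-cong {a ∷ p} {b ∷ q} x (coeffwise p≈q) =
    +-cong (p≈q zero) (*-congˡ (eval-cong {p} {q} x (coeffwise (p≈q ∘ suc))))

  eval-+ₚ : ∀ p q x → eval (p +ₚ q) x ≈ eval p x + eval q x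
  eval-+ₚ []      q       x = sym (+-identityˡ _)
  eval-+ₚ (a ∷ p) []      x = sym (+-identityʳ _)
  eval-+ₚ (a ∷ p) (b ∷ q) x = begin
    (a + b) + x * eval (p +ₚ q) x
      ≈⟨ +-congˡ (*-congˡ (eval-+ₚ p q x)) ⟩
    (a + b) + x * (eval p x + eval q x)
      ≈⟨ solve 5 (λ a b x s t → (a :+ b) :+ x :* (s :+ t) := (a :+ x :* s) :+ (b :+ x :* t))
                 refl a b x (eval p x) (eval q x) ⟩
    (a + x * eval p x) + (b + x * eval q x)
      ∎

  eval-·ₚ : ∀ k p x → eval (k ·ₚ p) x ≈ k * eval p x
  eval-·ₚ k []      x = sym (zeroʳ k)
  eval-·ₚ k (a ∷ p) x = begin
    k * a + x * eval (k ·ₚ p) x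
      ≈⟨ +-congˡ (*-congˡ (eval-·ₚ k p x)) ⟩
    k * a + x * (k * eval p x)
      ≈⟨ solve 4 (λ k a x s → k :* a :+ x :* (k :* s) := k :* (a :+ x :* s)) refl k a x (eval p x) ⟩
    k * (a + x * eval p x)
      ∎

  eval-*ₚ : ∀ p q x → eval (p *ₚ q) x ≈ eval p x * eval q x
  eval-*ₚ []      q x = sym (zeroˡ _)
  eval-*ₚ (a ∷ p) q x = begin
    eval (a ·ₚ q +ₚ (0# ∷ p *ₚ q)) x
      ≈⟨ eval-+ₚ (a ·ₚ q) (0# ∷ p *ₚ q) x ⟩
    eval (a ·ₚ q) x + (0# + x * eval (p *ₚ q) x)
      ≈⟨ +-cong (eval-·ₚ a q x) (trans (+-identityˡ _) (*-congˡ (eval-*ₚ p q x))) ⟩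
    a * eval q x + x * (eval p x * eval q x)
      ≈⟨ solve 4 (λ a x s t → a :* t :+ x :* (s :* t) := (a :+ x :* s) :* t) refl a x (eval p x) (eval q x) ⟩
    (a + x * eval p x) * eval q x
      ∎

  eval--ₚ : ∀ p x → eval (-ₚ p) x ≈ - eval p x
  eval--ₚ p x = trans (eval-·ₚ (- 1#) p x) (-1*x≈-x _)

  eval-lin : ∀ a b x → eval (lin a b) x ≈ a + x * b
  eval-lin a b x = +-congˡ (*-congˡ (trans (+-congˡ (zeroʳ x)) (+-identityʳ b)))

module PolynomialDegree {c ℓ} (F : Field c ℓ) where
  open Field F hiding (zero)
  open Poly F
  open PolynomialEquality F
  open PolynomialMultiplication F using (*ₚ-zeroˡ)
  open PolynomialEvaluation F using (eval-zero)
  open FieldProperties F using (*-cancelʳ)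
  open import Data.Nat using (_≤_; _>_; z≤n; s≤s)
  open import Data.Nat.Properties using (≤-trans; ≤-<-trans; ≤-pred; <⇒≤; m≤m+n; m≤n+m; +-monoˡ-≤; m≤n⇒m<n∨m≡n)
  open import Data.Sum using (inj₁; inj₂)
  open import Relation.Binary.Reasoning.Setoid setoid

  DegreeAtMost : K[X] → ℕ → Set ℓ
  DegreeAtMost p n = ∀ m → m > n → coeff p m ≈ 0#

  DegreeAtMost-cong : ∀ {p q n} → p ≋ q → DegreeAtMost p n → DegreeAtMost q n
  DegreeAtMost-cong (coeffwise p≈q) p≤n m m>n = trans (sym (p≈q m)) (p≤n m m>n)

  DegreeAtMost-mono : ∀ p {m n} → m ≤ n → DegreeAtMost p m → DegreeAtMost p n
  DegreeAtMost-mono p m≤n p≤m i i>n = p≤m i (≤-<-trans m≤n i>n)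

  DegreeAtMost-pred : ∀ p {n} → coeff p (suc n) ≈ 0# → DegreeAtMost p (suc n) → DegreeAtMost p n
  DegreeAtMost-pred p pₙ₊₁≈0 p≤1+n i i>n with m≤n⇒m<n∨m≡n i>n
  ... | inj₁ i>1+n  = p≤1+n i i>1+n
  ... | inj₂ ≡.refl = pₙ₊₁≈0

  DegreeAtMost-length : ∀ p k → DegreeAtMost p (length p ℕ.+ k)
  DegreeAtMost-length p k i i>ℓ+k = beyond p i (≤-trans (m≤m+n (length p) k) (<⇒≤ i>ℓ+k))
    where
    beyond : ∀ p i → length p ≤ i → coeff p i ≈ 0#
    beyond []      i       _         = refl
    beyond (a ∷ p) (suc i) (s≤s ℓ≤i) = beyond p i ℓ≤i

  lin-degree : ∀ a b → DegreeAtMost (lin a b) 1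
  lin-degree a b (suc zero)    (s≤s ())
  lin-degree a b (suc (suc m)) _ = refl

  +ₚ-degree : ∀ p q {n} → DegreeAtMost p n → DegreeAtMost q n → DegreeAtMost (p +ₚ q) n
  +ₚ-degree p q p≤n q≤n m m>n =
    trans (coeff-+ₚ p q m) (trans (+-cong (p≤n m m>n) (q≤n m m>n)) (+-identityʳ 0#))

  tail-zero : ∀ {a p} → DegreeAtMost (a ∷ p) 0 → p ≋ []
  tail-zero a∷p≤0 = coeffwise λ m → a∷p≤0 (suc m) (s≤s z≤n)

  tail-degree : ∀ {a p n} → DegreeAtMost (a ∷ p) (suc n) → DegreeAtMost p n
  tail-degree a∷p≤1+n m m>n = a∷p≤1+n (suc m) (s≤s m>n)

  coeff-∷*ₚ-zero : ∀ a p q → coeff ((a ∷ p) *ₚ q) 0 ≈ a * coeff q 0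
  coeff-∷*ₚ-zero a p q = trans (coeff-+ₚ (a ·ₚ q) (0# ∷ p *ₚ q) 0) (trans (+-identityʳ _) (coeff-·ₚ a q 0))

  coeff-∷*ₚ-suc : ∀ a p q n → coeff ((a ∷ p) *ₚ q) (suc n) ≈ a * coeff q (suc n) + coeff (p *ₚ q) n
  coeff-∷*ₚ-suc a p q n = trans (coeff-+ₚ (a ·ₚ q) (0# ∷ p *ₚ q) (suc n)) (+-congʳ (coeff-·ₚ a q (suc n)))

  *ₚ-degree : ∀ p q {m n} → DegreeAtMost p m → DegreeAtMost q n → DegreeAtMost (p *ₚ q) (m ℕ.+ n)
  *ₚ-degree []      q         p≤m q≤n i       _       = refl
  *ₚ-degree (a ∷ p) q {m} {n} p≤m q≤n (suc i) 1+i>m+n = begin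
    coeff ((a ∷ p) *ₚ q) (suc i)
      ≈⟨ coeff-∷*ₚ-suc a p q i ⟩
    a * coeff q (suc i) + coeff (p *ₚ q) i
      ≈⟨ +-cong (trans (*-congˡ (q≤n (suc i) 1+i>n)) (zeroʳ a)) (tail-vanishes m p≤m 1+i>m+n) ⟩
    0# + 0#
      ≈⟨ +-identityʳ 0# ⟩
    0#
      ∎
    where
    1+i>n : suc i > n
    1+i>n = s≤s (≤-trans (m≤n+m n m) (≤-pred 1+i>m+n))

    tail-vanishes : ∀ m → DegreeAtMost (a ∷ p) m → suc i > m ℕ.+ n → coeff (p *ₚ q) i ≈ 0#
    tail-vanishes zero    a∷p≤0   _       = coeff-≈ (*ₚ-zeroˡ p q (tail-zero a∷p≤0)) i
    tail-vanishes (suc m) a∷p≤1+m 1+i>m+n = *ₚ-degree p q (tail-degree a∷p≤1+m) q≤n i (≤-pred 1+i>m+n)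

  coeff-*ₚ-top : ∀ p q {m n} → DegreeAtMost p m → DegreeAtMost q n →
                 coeff (p *ₚ q) (m ℕ.+ n) ≈ coeff p m * coeff q n
  coeff-*ₚ-top []      q                 p≤m q≤n = sym (zeroˡ _)
  coeff-*ₚ-top (a ∷ p) q {zero}  {zero}  p≤m q≤n = coeff-∷*ₚ-zero a p q
  coeff-*ₚ-top (a ∷ p) q {zero}  {suc n} p≤m q≤n = begin
    coeff ((a ∷ p) *ₚ q) (suc n)
      ≈⟨ coeff-∷*ₚ-suc a p q n ⟩
    a * coeff q (suc n) + coeff (p *ₚ q) n
      ≈⟨ +-congˡ (coeff-≈ (*ₚ-zeroˡ p q (tail-zero p≤m)) n) ⟩
    a * coeff q (suc n) + 0#
      ≈⟨ +-identityʳ _ ⟩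
    a * coeff q (suc n)
      ∎
  coeff-*ₚ-top (a ∷ p) q {suc m} {n} p≤m q≤n = begin
    coeff ((a ∷ p) *ₚ q) (suc (m ℕ.+ n))
      ≈⟨ coeff-∷*ₚ-suc a p q (m ℕ.+ n) ⟩
    a * coeff q (suc (m ℕ.+ n)) + coeff (p *ₚ q) (m ℕ.+ n)
      ≈⟨ +-cong (trans (*-congˡ (q≤n _ (s≤s (m≤n+m n m)))) (zeroʳ a))
                (coeff-*ₚ-top p q (tail-degree p≤m) q≤n) ⟩
    0# + coeff p m * coeff q n
      ≈⟨ +-identityˡ _ ⟩
    coeff p m * coeff q n
      ∎

  degree-of-factor : ∀ p q {k n} → ¬ coeff q n ≈ 0# → DegreeAtMost q n →
                     DegreeAtMost (p *ₚ q) (k ℕ.+ n) → DegreeAtMost p k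
  degree-of-factor p q {k} {n} qₙ≉0 q≤n pq≤k+n = lower (length p) (DegreeAtMost-length p k)
    where
    lower : ∀ j → DegreeAtMost p (j ℕ.+ k) → DegreeAtMost p k
    lower zero    p≤k   = p≤k
    lower (suc j) p≤1+j+k = lower j (DegreeAtMost-pred p top-vanishes p≤1+j+k)
      where
      top-vanishes : coeff p (suc (j ℕ.+ k)) ≈ 0#
      top-vanishes = *-cancelʳ qₙ≉0 (begin
        coeff p (suc (j ℕ.+ k)) * coeff q n      ≈⟨ coeff-*ₚ-top p q p≤1+j+k q≤n ⟨
        coeff (p *ₚ q) (suc (j ℕ.+ k) ℕ.+ n)     ≈⟨ pq≤k+n _ (s≤s (+-monoˡ-≤ n (m≤n+m k j))) ⟩
        0#                                       ≈⟨ zeroˡ _ ⟨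
        0# * coeff q n                           ∎)

  constant-eval : ∀ p x → DegreeAtMost p 0 → eval p x ≈ coeff p 0
  constant-eval []      x _     = refl
  constant-eval (a ∷ p) x a∷p≤0 =
    trans (+-congˡ (trans (*-congˡ (eval-zero p x (tail-zero a∷p≤0))) (zeroʳ x))) (+-identityʳ a)

module ContinuedFraction {c ℓ} (F : Field c ℓ) where
  open Field F
  open Poly F
  open PolynomialEquality F
  open PolynomialMultiplication F
  open PolynomialEvaluation F
  open PolynomialDegree F
  open FieldProperties F
  open IntegerCoefficients commutativeRing using (solve; _:=_; _:+_; _:*_; _:-_; :-_)
  open import Algebra.Properties.Ring ring using (-0#≈0#; -‿involutive)
  open import Data.Nat using (s≤s; z≤n)
  open import Data.Product using (proj₁; proj₂)
  open import Relation.Binary.Reasoning.Setoid setoid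

  module Expansion
    (A : K[X]) (A-monic : MonicOfDegree A 3)
    (v w : Carrier) (v≉0 : ¬ v ≈ 0#)
    (d e : ℤ → Carrier) (Q a : ℤ → K[X])
    (Q-degree : ∀ h → HasDegree (Q h) 2)
    (sum-rel : ∀ h → (lin (d h * e h) (d h) +ₚ lin (d (h +ℤ + 1) * e (h +ℤ + 1)) (d (h +ℤ + 1)) +ₚ A)
                       ≈ₚ a h *ₚ Q h)
    (product-rel : ∀ h → -ₚ (Q h *ₚ Q (h +ℤ + 1))
                           ≈ₚ (-ₚ (lin (v * w) (- v)))
                              +ₚ lin (d (h +ℤ + 1) * e (h +ℤ + 1)) (d (h +ℤ + 1))
                                 *ₚ (A +ₚ lin (d (h +ℤ + 1) * e (h +ℤ + 1)) (d (h +ℤ + 1))))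
    where

    next : ℤ → ℤ
    next h = h +ℤ + 1

    P : ℤ → K[X]
    P h = lin (d h * e h) (d h)

    R : K[X]
    R = lin (v * w) (- v)

    sum-relation : ∀ h → P h +ₚ P (next h) +ₚ A ≋ a h *ₚ Q h
    sum-relation h = coeffwise (sum-rel h)

    product-relation : ∀ h → -ₚ (Q h *ₚ Q (next h)) ≋ -ₚ R +ₚ P (next h) *ₚ (A +ₚ P (next h))
    product-relation h = coeffwise (product-rel h)

    M : ℤ → K[X]
    M h = Q h +ₚ P (next h) *ₚ a (next h)

    key-identity : ∀ h → M h *ₚ Q (next h) ≋ R +ₚ P (next h) *ₚ P (next (next h))
    key-identity h = eliminate-A (Q h) (Q (next h)) (P (next h)) (P (next (next h))) A (a (next h)) R
                       (sum-relation (next h)) (product-relation h)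

    M-constant : ∀ h → DegreeAtMost (M h) 0
    M-constant h =
      degree-of-factor (M h) (Q (next h)) (proj₁ (Q-degree (next h))) (proj₂ (Q-degree (next h)))
        (DegreeAtMost-cong (≋-sym (key-identity h))
          (+ₚ-degree R (P (next h) *ₚ P (next (next h)))
            (DegreeAtMost-mono R (s≤s z≤n) (lin-degree (v * w) (- v)))
            (*ₚ-degree (P (next h)) (P (next (next h))) (lin-degree _ _) (lin-degree _ _))))

    m : ℤ → Carrier
    m h = coeff (M h) 0

    lc : ℤ → Carrier
    lc h = coeff (Q h) 2

    m*lc≈d*d : ∀ h → m h * lc (next h) ≈ d (next h) * d (next (next h))
    m*lc≈d*d h = begin
      m h * lc (next h)             ≈⟨ coeff-*ₚ-top (M h) Q₁ (M-constant h) (proj₂ (Q-degree (next h))) ⟨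
      coeff (M h *ₚ Q₁) 2           ≈⟨ coeff-≈ (key-identity h) 2 ⟩
      coeff (R +ₚ P₁ *ₚ P₂) 2       ≈⟨ coeff-+ₚ R (P₁ *ₚ P₂) 2 ⟩
      0# + coeff (P₁ *ₚ P₂) 2       ≈⟨ +-identityˡ _ ⟩
      coeff (P₁ *ₚ P₂) 2            ≈⟨ coeff-*ₚ-top P₁ P₂ (lin-degree _ _) (lin-degree _ _) ⟩
      d (next h) * d (next (next h)) ∎
      where
      P₁ P₂ Q₁ : K[X]
      P₁ = P (next h)
      P₂ = P (next (next h))
      Q₁ = Q (next h)

    -lc*lc≈d : ∀ h → - (lc h * lc (next h)) ≈ d (next h)
    -lc*lc≈d h = begin
      - (lc h * lc (next h))
        ≈⟨ -‿cong (coeff-*ₚ-top (Q h) Q₁ (proj₂ (Q-degree h)) (proj₂ (Q-degree (next h)))) ⟨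
      - coeff (Q h *ₚ Q₁) 4
        ≈⟨ coeff--ₚ (Q h *ₚ Q₁) 4 ⟨
      coeff (-ₚ (Q h *ₚ Q₁)) 4
        ≈⟨ coeff-≈ (product-relation h) 4 ⟩
      coeff (-ₚ R +ₚ P₁ *ₚ (A +ₚ P₁)) 4
        ≈⟨ coeff-+ₚ (-ₚ R) (P₁ *ₚ (A +ₚ P₁)) 4 ⟩
      0# + coeff (P₁ *ₚ (A +ₚ P₁)) 4
        ≈⟨ +-identityˡ _ ⟩
      coeff (P₁ *ₚ (A +ₚ P₁)) 4
        ≈⟨ coeff-*ₚ-top P₁ (A +ₚ P₁) (lin-degree _ _) A+P₁≤3 ⟩
      d (next h) * coeff (A +ₚ P₁) 3
        ≈⟨ *-congˡ (trans (coeff-+ₚ A P₁ 3) (+-identityʳ _)) ⟩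
      d (next h) * coeff A 3
        ≈⟨ *-congˡ (proj₁ A-monic) ⟩
      d (next h) * 1#
        ≈⟨ *-identityʳ _ ⟩
      d (next h)
        ∎
      where
      P₁ Q₁ : K[X]
      P₁ = P (next h)
      Q₁ = Q (next h)

      A+P₁≤3 : DegreeAtMost (A +ₚ P₁) 3
      A+P₁≤3 = +ₚ-degree A P₁ (proj₂ A-monic) (DegreeAtMost-mono P₁ (s≤s z≤n) (lin-degree _ _))

    d≉0 : ∀ h → ¬ d (next h) ≈ 0#
    d≉0 h d≈0 = x≉0⇒-x≉0 (x≉0∧y≉0⇒x*y≉0 (proj₁ (Q-degree h)) (proj₁ (Q-degree (next h))))
                          (trans (-lc*lc≈d h) d≈0)

    u : ℤ → Carrier
    u h = w + e h

    W : ℤ → Carrier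
    W h = eval (Q h) w

    eval-P : ∀ h x → eval (P h) x ≈ d h * (x + e h)
    eval-P h x = trans (eval-lin (d h * e h) (d h) x)
                       (solve 3 (λ d e x → d :* e :+ x :* d := d :* (x :+ e)) refl (d h) (e h) x)

    eval-P-root : ∀ h → eval (P h) (- e h) ≈ 0#
    eval-P-root h = trans (eval-P h (- e h)) (trans (*-congˡ (-‿inverseˡ (e h))) (zeroʳ (d h)))

    eval-R-root : eval R w ≈ 0#
    eval-R-root = trans (eval-lin (v * w) (- v) w)
                        (trans (solve 2 (λ v w → v :* w :+ w :* (:- v) := v :* w :- v :* w) refl v w)
                               (-‿inverseʳ (v * w)))

    eval-R-neg : ∀ y → eval R (- y) ≈ v * (w + y)
    eval-R-neg y = trans (eval-lin (v * w) (- v) (- y))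
                         (solve 3 (λ v w y → v :* w :+ (:- y) :* (:- v) := v :* (w :+ y)) refl v w y)

    eval-M : ∀ h x → eval (M h) x ≈ m h
    eval-M h x = constant-eval (M h) x (M-constant h)

    key-identity-at : ∀ h x → m h * eval (Q (next h)) x ≈ eval R x + eval (P (next h)) x * eval (P (next (next h))) x
    key-identity-at h x = begin
      m h * eval Q₁ x                  ≈⟨ *-congʳ (eval-M h x) ⟨
      eval (M h) x * eval Q₁ x         ≈⟨ eval-*ₚ (M h) Q₁ x ⟨
      eval (M h *ₚ Q₁) x               ≈⟨ eval-cong x (key-identity h) ⟩
      eval (R +ₚ P₁ *ₚ P₂) x           ≈⟨ eval-+ₚ R (P₁ *ₚ P₂) x ⟩
      eval R x + eval (P₁ *ₚ P₂) x     ≈⟨ +-congˡ (eval-*ₚ P₁ P₂ x) ⟩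
      eval R x + eval P₁ x * eval P₂ x ∎
      where
      P₁ P₂ Q₁ : K[X]
      P₁ = P (next h)
      P₂ = P (next (next h))
      Q₁ = Q (next h)

    m≈Q[-e] : ∀ h → m h ≈ eval (Q h) (- e (next h))
    m≈Q[-e] h = begin
      m h                                      ≈⟨ eval-M h y ⟨
      eval (M h) y                             ≈⟨ eval-+ₚ (Q h) (P₁ *ₚ a₁) y ⟩
      eval (Q h) y + eval (P₁ *ₚ a₁) y         ≈⟨ +-congˡ (eval-*ₚ P₁ a₁ y) ⟩
      eval (Q h) y + eval P₁ y * eval a₁ y     ≈⟨ +-congˡ (trans (*-congʳ (eval-P-root (next h))) (zeroˡ _)) ⟩
      eval (Q h) y + 0#                        ≈⟨ +-identityʳ _ ⟩
      eval (Q h) y                             ∎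
      where
      y : Carrier
      y = - e (next h)

      P₁ a₁ : K[X]
      P₁ = P (next h)
      a₁ = a (next h)

    m*m≈v*u : ∀ h → m h * m (next h) ≈ v * u (next (next h))
    m*m≈v*u h = begin
      m h * m (next h)
        ≈⟨ *-congˡ (m≈Q[-e] (next h)) ⟩
      m h * eval (Q (next h)) y
        ≈⟨ key-identity-at h y ⟩
      eval R y + eval P₁ y * eval P₂ y
        ≈⟨ +-cong (eval-R-neg _) (trans (*-congˡ (eval-P-root (next (next h)))) (zeroʳ _)) ⟩
      v * u (next (next h)) + 0#
        ≈⟨ +-identityʳ _ ⟩
      v * u (next (next h))
        ∎
      where
      y : Carrier
      y = - e (next (next h))

      P₁ P₂ : K[X]
      P₁ = P (next h)
      P₂ = P (next (next h))

    key-identity-at-w : ∀ h → m h * W (next h) ≈ (d (next h) * u (next h)) * (d (next (next h)) * u (next (next h)))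
    key-identity-at-w h = begin
      m h * W (next h)                                   ≈⟨ key-identity-at h w ⟩
      eval R w + eval (P (next h)) w * eval (P (next (next h))) w
        ≈⟨ +-cong eval-R-root (*-cong (eval-P (next h) w) (eval-P (next (next h)) w)) ⟩
      0# + (d (next h) * u (next h)) * (d (next (next h)) * u (next (next h)))
        ≈⟨ +-identityˡ _ ⟩
      (d (next h) * u (next h)) * (d (next (next h)) * u (next (next h)))
        ∎

    product-relation-at-w : ∀ h → W h * W (next h) ≈ - ((d (next h) * u (next h)) * (eval A w + d (next h) * u (next h)))
    product-relation-at-w h = begin
      W h * W (next h)
        ≈⟨ eval-*ₚ (Q h) (Q (next h)) w ⟨
      eval (Q h *ₚ Q (next h)) w
        ≈⟨ -‿involutive _ ⟨
      - - eval (Q h *ₚ Q (next h)) w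
        ≈⟨ -‿cong (eval--ₚ (Q h *ₚ Q (next h)) w) ⟨
      - eval (-ₚ (Q h *ₚ Q (next h))) w
        ≈⟨ -‿cong (eval-cong w (product-relation h)) ⟩
      - eval (-ₚ R +ₚ P₁ *ₚ (A +ₚ P₁)) w
        ≈⟨ -‿cong (eval-+ₚ (-ₚ R) (P₁ *ₚ (A +ₚ P₁)) w) ⟩
      - (eval (-ₚ R) w + eval (P₁ *ₚ (A +ₚ P₁)) w)
        ≈⟨ -‿cong (+-cong (trans (eval--ₚ R w) (trans (-‿cong eval-R-root) -0#≈0#)) (eval-*ₚ P₁ (A +ₚ P₁) w)) ⟩
      - (0# + eval P₁ w * eval (A +ₚ P₁) w)
        ≈⟨ -‿cong (+-identityˡ _) ⟩
      - (eval P₁ w * eval (A +ₚ P₁) w)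
        ≈⟨ -‿cong (*-cong (eval-P (next h) w) (trans (eval-+ₚ A P₁ w) (+-congˡ (eval-P (next h) w)))) ⟩
      - ((d (next h) * u (next h)) * (eval A w + d (next h) * u (next h)))
        ∎
      where
      P₁ : K[X]
      P₁ = P (next h)

    v*u≈-d*d*d : ∀ h → v * u (next (next h)) ≈ - (d (next h) * d (next (next h)) * d (next (next (next h))))
    v*u≈-d*d*d h = *-cancelˡ (d≉0 (next h)) (begin
      d₂ * (v * u (next (next h)))
        ≈⟨ *-cong (-lc*lc≈d (next h)) (m*m≈v*u h) ⟨
      - (ℓ₁ * ℓ₂) * (m₀ * m₁)
        ≈⟨ solve 4 (λ ℓ₁ ℓ₂ m₀ m₁ → (:- (ℓ₁ :* ℓ₂)) :* (m₀ :* m₁) := :- ((m₀ :* ℓ₁) :* (m₁ :* ℓ₂)))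
                 refl ℓ₁ ℓ₂ m₀ m₁ ⟩
      - ((m₀ * ℓ₁) * (m₁ * ℓ₂))
        ≈⟨ -‿cong (*-cong (m*lc≈d*d h) (m*lc≈d*d (next h))) ⟩
      - ((d₁ * d₂) * (d₂ * d₃))
        ≈⟨ solve 3 (λ d₁ d₂ d₃ → :- ((d₁ :* d₂) :* (d₂ :* d₃)) := d₂ :* (:- (d₁ :* d₂ :* d₃)))
                 refl d₁ d₂ d₃ ⟩
      d₂ * - (d₁ * d₂ * d₃)
        ∎)
      where
      d₁ d₂ d₃ m₀ m₁ ℓ₁ ℓ₂ : Carrier
      d₁ = d (next h)
      d₂ = d (next (next h))
      d₃ = d (next (next (next h)))
      m₀ = m h
      m₁ = m (next h)
      ℓ₁ = lc (next h)
      ℓ₂ = lc (next (next h))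

    u≉0 : ∀ h → ¬ u (next (next h)) ≈ 0#
    u≉0 h u≈0 = x≉0⇒-x≉0 d*d*d≉0 (trans (sym (v*u≈-d*d*d h)) (trans (*-congˡ u≈0) (zeroʳ v)))
      where
      d*d*d≉0 : ¬ d (next h) * d (next (next h)) * d (next (next (next h))) ≈ 0#
      d*d*d≉0 = x≉0∧y≉0⇒x*y≉0 (x≉0∧y≉0⇒x*y≉0 (d≉0 h) (d≉0 (next h))) (d≉0 (next (next h)))

    middle-relation : ∀ h →
      - (v * (eval A w + d (next (next h)) * u (next (next h))))
        ≈ d (next h) * d (next (next h)) * d (next (next (next h))) * u (next h) * u (next (next (next h)))
    middle-relation h = *-cancelˡ (x≉0∧y≉0⇒x*y≉0 (x≉0∧y≉0⇒x*y≉0 (d≉0 (next h)) (u≉0 h)) (u≉0 h)) (begin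
      d₀ * u₀ * u₀ * - (v * (α + d₀ * u₀))
        ≈⟨ solve 4 (λ d₀ u₀ v α → d₀ :* u₀ :* u₀ :* (:- (v :* (α :+ d₀ :* u₀)))
                                  := (v :* u₀) :* (:- ((d₀ :* u₀) :* (α :+ d₀ :* u₀))))
                 refl d₀ u₀ v α ⟩
      (v * u₀) * - ((d₀ * u₀) * (α + d₀ * u₀))
        ≈⟨ *-cong (m*m≈v*u h) (product-relation-at-w (next h)) ⟨
      (m h * m (next h)) * (W (next h) * W (next (next h)))
        ≈⟨ solve 4 (λ m₋₂ m₋₁ W₋₁ W₀ → (m₋₂ :* m₋₁) :* (W₋₁ :* W₀) := (m₋₂ :* W₋₁) :* (m₋₁ :* W₀))
                 refl (m h) (m (next h)) (W (next h)) (W (next (next h))) ⟩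
      (m h * W (next h)) * (m (next h) * W (next (next h)))
        ≈⟨ *-cong (key-identity-at-w h) (key-identity-at-w (next h)) ⟩
      ((d₋₁ * u₋₁) * (d₀ * u₀)) * ((d₀ * u₀) * (d₁ * u₁))
        ≈⟨ solve 6 (λ d₋₁ d₀ d₁ u₋₁ u₀ u₁ → ((d₋₁ :* u₋₁) :* (d₀ :* u₀)) :* ((d₀ :* u₀) :* (d₁ :* u₁))
                                            := d₀ :* u₀ :* u₀ :* (d₋₁ :* d₀ :* d₁ :* u₋₁ :* u₁))
                 refl d₋₁ d₀ d₁ u₋₁ u₀ u₁ ⟩
      d₀ * u₀ * u₀ * (d₋₁ * d₀ * d₁ * u₋₁ * u₁)
        ∎)
      where
      d₋₁ d₀ d₁ u₋₁ u₀ u₁ α : Carrier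
      d₋₁ = d (next h)
      d₀  = d (next (next h))
      d₁  = d (next (next (next h)))
      u₋₁ = u (next h)
      u₀  = u (next (next h))
      u₁  = u (next (next (next h)))
      α   = eval A w

    FiveTermRelation : ℤ → ℤ → ℤ → ℤ → ℤ → Set ℓ
    FiveTermRelation i₋₂ i₋₁ i₀ i₁ i₂ =
      d i₋₂ * (d i₋₁ * d i₋₁) * (d i₀ * d i₀ * d i₀) * (d i₁ * d i₁) * d i₂
        ≈ (v * v) * d i₋₁ * (d i₀ * d i₀) * d i₁ - (v * v * v) * eval A w

    -- Consecutive indices are linked by equations, since for instance (h - 1) + 1 is not definitionally h.
    five-term-relation : ∀ {i₋₃ i₋₂ i₋₁ i₀ i₁ i₂} →
                         next i₋₃ ≡ i₋₂ → next i₋₂ ≡ i₋₁ → next i₋₁ ≡ i₀ → next i₀ ≡ i₁ → next i₁ ≡ i₂ →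
                         FiveTermRelation i₋₂ i₋₁ i₀ i₁ i₂
    five-term-relation {i₋₃} ≡.refl ≡.refl ≡.refl ≡.refl ≡.refl = begin
      d₋₂ * (d₋₁ * d₋₁) * (d₀ * d₀ * d₀) * (d₁ * d₁) * d₂
        ≈⟨ solve 5 (λ d₋₂ d₋₁ d₀ d₁ d₂ → d₋₂ :* (d₋₁ :* d₋₁) :* (d₀ :* d₀ :* d₀) :* (d₁ :* d₁) :* d₂
                                          := (d₋₁ :* d₀ :* d₁) :* ((d₋₂ :* d₋₁ :* d₀) :* (d₀ :* d₁ :* d₂)))
                 refl d₋₂ d₋₁ d₀ d₁ d₂ ⟩
      (d₋₁ * d₀ * d₁) * ((d₋₂ * d₋₁ * d₀) * (d₀ * d₁ * d₂))
        ≈⟨ *-congˡ (*-cong (x≈-y⇒y≈-x (v*u≈-d*d*d i₋₃)) (x≈-y⇒y≈-x (v*u≈-d*d*d (next k₋₂)))) ⟩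
      (d₋₁ * d₀ * d₁) * (- (v * u₋₁) * - (v * u₁))
        ≈⟨ solve 6 (λ d₋₁ d₀ d₁ v u₋₁ u₁ → (d₋₁ :* d₀ :* d₁) :* ((:- (v :* u₋₁)) :* (:- (v :* u₁)))
                                            := (v :* v) :* (d₋₁ :* d₀ :* d₁ :* u₋₁ :* u₁))
                 refl d₋₁ d₀ d₁ v u₋₁ u₁ ⟩
      (v * v) * (d₋₁ * d₀ * d₁ * u₋₁ * u₁)
        ≈⟨ *-congˡ (middle-relation k₋₂) ⟨
      (v * v) * - (v * (α + d₀ * u₀))
        ≈⟨ solve 4 (λ v α d₀ u₀ → (v :* v) :* (:- (v :* (α :+ d₀ :* u₀)))
                                   := (v :* v) :* d₀ :* (:- (v :* u₀)) :- (v :* v :* v) :* α)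
                 refl v α d₀ u₀ ⟩
      (v * v) * d₀ * - (v * u₀) - (v * v * v) * α
        ≈⟨ +-congʳ (*-congˡ (-‿cong (v*u≈-d*d*d k₋₂))) ⟩
      (v * v) * d₀ * - - (d₋₁ * d₀ * d₁) - (v * v * v) * α
        ≈⟨ solve 5 (λ v α d₋₁ d₀ d₁ → (v :* v) :* d₀ :* (:- (:- (d₋₁ :* d₀ :* d₁))) :- (v :* v :* v) :* α
                                       := (v :* v) :* d₋₁ :* (d₀ :* d₀) :* d₁ :- (v :* v :* v) :* α)
                 refl v α d₋₁ d₀ d₁ ⟩
      (v * v) * d₋₁ * (d₀ * d₀) * d₁ - (v * v * v) * α
        ∎
      where
      k₋₂ : ℤ
      k₋₂ = next i₋₃

      d₋₂ d₋₁ d₀ d₁ d₂ u₋₁ u₀ u₁ α : Carrier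
      d₋₂ = d k₋₂
      d₋₁ = d (next k₋₂)
      d₀  = d (next (next k₋₂))
      d₁  = d (next (next (next k₋₂)))
      d₂  = d (next (next (next (next k₋₂))))
      u₋₁ = u (next k₋₂)
      u₀  = u (next (next k₋₂))
      u₁  = u (next (next (next k₋₂)))
      α   = eval A w

mainTheorem3 : ∀ {c ℓ : Level} (F : Field c ℓ) →
    let open Field F
        open Poly F
    in (A : K[X]) → MonicOfDegree A 3 →
       (v w : Carrier) → ¬ (v ≈ 0#) →
       (d e : ℤ → Carrier) → (Q a : ℤ → K[X]) →
       (∀ h → HasDegree (Q h) 2) →
       -- R = -v (X - w),  P_h = d_h (X + e_h)
       (∀ h → (lin (d h * e h) (d h) +ₚ lin (d (h +ℤ + 1) * e (h +ℤ + 1)) (d (h +ℤ + 1)) +ₚ A)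
                ≈ₚ a h *ₚ Q h) →
       (∀ h → -ₚ (Q h *ₚ Q (h +ℤ + 1))
                ≈ₚ (-ₚ (lin (v * w) (- v)))
                   +ₚ lin (d (h +ℤ + 1) * e (h +ℤ + 1)) (d (h +ℤ + 1))
                      *ₚ (A +ₚ lin (d (h +ℤ + 1) * e (h +ℤ + 1)) (d (h +ℤ + 1)))) →
       ∀ h →
         d (h -ℤ + 2) * (d (h -ℤ + 1) * d (h -ℤ + 1))
           * (d h * d h * d h) * (d (h +ℤ + 1) * d (h +ℤ + 1)) * d (h +ℤ + 2)
         ≈ (v * v) * d (h -ℤ + 1) * (d h * d h) * d (h +ℤ + 1)
           - (v * v * v) * eval A w
mainTheorem3 F A A-monic v w v≉0 d e Q a Q-degree sum-rel product-rel h =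
  five-term-relation {h -ℤ + 3}
    (ℤ.+-assoc h (ℤ.- + 3) (+ 1))
    (ℤ.+-assoc h (ℤ.- + 2) (+ 1))
    (≡.trans (ℤ.+-assoc h (ℤ.- + 1) (+ 1)) (ℤ.+-identityʳ h))
    ≡.refl
    (ℤ.+-assoc h (+ 1) (+ 1))
  where open ContinuedFraction.Expansion F A A-monic v w v≉0 d e Q a Q-degree sum-rel product-rel
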